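{- Let $m>n\ge1$ be integers, $k\ge1$, and $r_1,\dots,r_k$, $s_1,\dots,s_k$ positive integers with $\sum_i r_i=m$ and $\sum_i s_i=n$. For $p\in[k-1]$ set $a_p=\sum_{i=1}^p(nr_i-ms_i)$. Let $\Lambda=(c_1,\dots,c_n\,|\,b_1,\dots,b_m)\in\mathbb Z^{n|m}$ where $(b_1,\dots,b_m)$ is the concatenation of the blocks $(0,n,2n,\dots,(r_1-1)n)$ and, for $i=1,\dots,k-1$, $(a_i,a_i+n,\dots,a_i+(r_{i+1}-1)n)$; and $(c_1,\dots,c_n)$ is the concatenation of the blocks $(a_i+(s_i-1)m,\dots,a_i+m,a_i)$ for $i=1,\dots,k-1$, followed by $((s_k-1)m,\dots,m,0)$. Then $\Lambda$ lies in the $\mathfrak W$-orbit of $\Lambda_0$.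
   Context: Elements of $\mathbb Z^{n|m}$ are written $(c_1,\dots,c_n|b_1,\dots,b_m)$, identified with $\sum c_i\epsilon_i-\sum b_j\delta_j$, with form $(\epsilon_i,\epsilon_l)=\delta_{il}=-(\delta_i,\delta_l)$, $(\epsilon_i,\delta_j)=0$, so $(\Lambda,\epsilon_i-\delta_j)=c_i-b_j$. $\Lambda_0=(m(n-1),\dots,m,0\,|\,0,n,\dots,n(m-1))$. For $\alpha=\epsilon_i-\delta_j$ let $v_\alpha=n\epsilon_i-m\delta_j$, $\Pi_\alpha=\{\Lambda:(\Lambda,\alpha)=0\}$, $\Pi_{ -\alpha}=\{\Lambda:(\Lambda,\alpha)=n-m\}$, $\tau_{\pm\alpha}(\Lambda)=\Lambda\pm v_\alpha$ for $\Lambda\in\Pi_{\pm\alpha}$. The $\mathfrak W$-orbit of $\Lambda_0$ (for the Sergeev–Veselov action with parameter $-n/m$) is the smallest subset of $\mathbb Z^{n|m}$ containing $\Lambda_0$ that is closed under all maps $\tau_{\pm\alpha}$ (applied where defined) and under all permutations of the first $n$ coordinates among themselves and of the last $m$ coordinates among themselves. -}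

module Defs where

open import Data.Nat as ℕ using (ℕ; zero; suc; _∸_)
open import Data.Integer as ℤ using (ℤ; +_; _+_; _-_; _*_)
open import Data.Fin using (Fin; toℕ)
open import Data.Fin.Permutation using (Permutation′; _⟨$⟩ʳ_)
open import Data.Vec as V using (Vec; lookup; tabulate; updateAt)
open import Data.List as L using (List; applyUpTo; concat; reverse; _++_)
open import Relation.Binary.PropositionalEquality using (_≡_)
open import Data.Nat.ListAction using (sum)

-- An element (c₁,…,cₙ | b₁,…,bₘ) of ℤ^{n|m} is a pair of vectors (c , b).
-- Indices are 0-based in Agda: coordinate c_{i+1} is lookup c i.

Λ₀c : (n m : ℕ) → Vec ℤ n
Λ₀c n m = tabulate (λ i → + (m ℕ.* (n ∸ suc (toℕ i))))

Λ₀b : (n m : ℕ) → Vec ℤ m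
Λ₀b n m = tabulate (λ j → + (n ℕ.* toℕ j))

permute : ∀ {n} → Permutation′ n → Vec ℤ n → Vec ℤ n
permute π v = tabulate (λ i → lookup v (π ⟨$⟩ʳ i))

-- The 𝔚-orbit of Λ₀ (Sergeev–Veselov action with parameter -n/m):
-- the smallest set containing Λ₀, closed under τ_{±α} (α = ε_i - δ_j)
-- where defined, and under permutations of the c's and of the b's.
-- Since Λ = Σ cᵢ εᵢ - Σ bⱼ δⱼ, adding v_α = n εᵢ - m δⱼ means
-- cᵢ ↦ cᵢ + n, bⱼ ↦ bⱼ + m; and (Λ , α) = cᵢ - bⱼ.
data InOrbit (n m : ℕ) : Vec ℤ n → Vec ℤ m → Set where
  base : InOrbit n m (Λ₀c n m) (Λ₀b n m)
  τ₊ : ∀ {c b} (i : Fin n) (j : Fin m) →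
       InOrbit n m c b →
       lookup c i - lookup b j ≡ + 0 →
       InOrbit n m (updateAt c i (λ x → x + + n)) (updateAt b j (λ x → x + + m))
  τ₋ : ∀ {c b} (i : Fin n) (j : Fin m) →
       InOrbit n m c b →
       lookup c i - lookup b j ≡ + n - + m →
       InOrbit n m (updateAt c i (λ x → x - + n)) (updateAt b j (λ x → x - + m))
  permC : ∀ {c b} (π : Permutation′ n) → InOrbit n m c b → InOrbit n m (permute π c) b
  permB : ∀ {c b} (π : Permutation′ m) → InOrbit n m c b → InOrbit n m c (permute π b)

Σ1 : ℕ → (ℕ → ℕ) → ℕ
Σ1 k f = sum (applyUpTo (λ i → f (suc i)) k)

aSeq : (n m : ℕ) (r s : ℕ → ℕ) → ℕ → ℤ
aSeq n m r s zero = + 0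
aSeq n m r s (suc p) = aSeq n m r s p + (+ (n ℕ.* r (suc p)) - + (m ℕ.* s (suc p)))

bBlock : (n : ℕ) → ℤ → ℕ → List ℤ
bBlock n st len = applyUpTo (λ j → st + + (n ℕ.* j)) len

cBlock : (m : ℕ) → ℤ → ℕ → List ℤ
cBlock m st len = reverse (applyUpTo (λ j → st + + (m ℕ.* j)) len)

bList : (n m k : ℕ) (r s : ℕ → ℕ) → List ℤ
bList n m k r s =
  bBlock n (+ 0) (r 1) ++
  concat (applyUpTo (λ i → bBlock n (aSeq n m r s (suc i)) (r (suc (suc i)))) (k ∸ 1))

cList : (n m k : ℕ) (r s : ℕ → ℕ) → List ℤ
cList n m k r s =
  concat (applyUpTo (λ i → cBlock m (aSeq n m r s (suc i)) (s (suc i))) (k ∸ 1)) ++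
  cBlock m (+ 0) (s k)

module Submission where

open import Defs
open import Data.Nat using (ℕ; _≤_; _<_)
open import Data.Integer using (ℤ)
open import Data.Vec using (Vec; toList)
open import Relation.Binary.PropositionalEquality using (_≡_)

-- Read a word in the letters U, D as a lattice path from height 0 with steps +n (U) and −m (D).
-- Recording the height at which each U starts as a b-coordinate and the height at which each D
-- ends as a c-coordinate, both in path order, turns the path UᵐDⁿ into Λ₀. Replacing a factor
-- UD starting at height h by DU is a single τ₋: it moves the b-coordinate h and the c-coordinate
-- h + n − m, whose difference is n − m, down by m and n respectively. Bubble sorting UᵐDⁿ into
-- U^{r₁}D^{s₁}⋯U^{r_k}D^{s_k} therefore stays in the orbit, and that path records exactly Λ:
-- its i-th UD-block starts at height a_{i−1}, and it ends at height a_k = nm − mn = 0.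

import Data.Nat as ℕ
open import Data.Nat using (zero; suc; _∸_)
import Data.Nat.Properties as ℕ
open import Data.Nat.ListAction using (sum)
import Data.Nat.ListAction.Properties as ℕ
open import Data.Integer using (+_; _+_; _-_)
import Data.Integer.Properties as ℤ
open import Data.Integer.Solver using (module +-*-Solver)
open import Data.Fin using (Fin; toℕ) renaming (zero to fzero; suc to fsuc)
open import Data.Vec using ([]; _∷_; lookup; tabulate; updateAt)
open import Data.Vec.Properties using (toList-injective; cast-is-id)
open import Data.List
  using (List; []; _∷_; _++_; _∷ʳ_; replicate; applyUpTo; applyDownFrom; concat)
import Data.List.Properties as List
open import Data.Product using (Σ; _×_; _,_)
open import Function using (_∘_)
open import Relation.Binary.Construct.Closure.ReflexiveTransitive using (Star; ε; _◅_; _◅◅_; gmap)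
open import Relation.Binary.PropositionalEquality
  using (refl; sym; trans; cong; cong₂; subst; subst₂; module ≡-Reasoning)

open +-*-Solver

applyUpTo-cong : ∀ {A : Set} {f g : ℕ → A} → (∀ i → f i ≡ g i) →
                 ∀ L → applyUpTo f L ≡ applyUpTo g L
applyUpTo-cong f≗g zero    = refl
applyUpTo-cong f≗g (suc L) = cong₂ _∷_ (f≗g 0) (applyUpTo-cong (f≗g ∘ suc) L)

replicate-+ : ∀ {A : Set} (x : A) a b → replicate (a ℕ.+ b) x ≡ replicate a x ++ replicate b x
replicate-+ x zero    b = refl
replicate-+ x (suc a) b = cong (x ∷_) (replicate-+ x a b)

toList-tabulate-upward : ∀ {A : Set} N (g : ℕ → A) →
                         toList (tabulate {n = N} (λ i → g (toℕ i))) ≡ applyUpTo g N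
toList-tabulate-upward zero    g = refl
toList-tabulate-upward (suc N) g = cong (g 0 ∷_) (toList-tabulate-upward N (g ∘ suc))

toList-tabulate-downward : ∀ {A : Set} N (g : ℕ → A) →
                           toList (tabulate {n = N} (λ i → g (N ∸ suc (toℕ i)))) ≡ applyDownFrom g N
toList-tabulate-downward zero    g = refl
toList-tabulate-downward (suc N) g = cong (g N ∷_) (toList-tabulate-downward N g)

toList-injective-≡ : ∀ {A : Set} {k} (u v : Vec A k) → toList u ≡ toList v → u ≡ v
toList-injective-≡ u v eq = trans (sym (cast-is-id refl u)) (toList-injective refl u v eq)

index-of-toList-split : ∀ {A : Set} {k} (v : Vec A k) P u Q (f : A → A) → toList v ≡ P ++ u ∷ Q →
                        Σ (Fin k) λ i → lookup v i ≡ u × toList (updateAt v i f) ≡ P ++ f u ∷ Q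
index-of-toList-split []      []      u Q f ()
index-of-toList-split []      (_ ∷ P) u Q f ()
index-of-toList-split (x ∷ v) []      u Q f eq =
  fzero , List.∷-injectiveˡ eq , cong₂ _∷_ (cong f (List.∷-injectiveˡ eq)) (List.∷-injectiveʳ eq)
index-of-toList-split (x ∷ v) (_ ∷ P) u Q f eq
  with index-of-toList-split v P u Q f (List.∷-injectiveʳ eq)
... | i , vᵢ≡u , v′≡ = fsuc i , vᵢ≡u , cong₂ _∷_ (List.∷-injectiveˡ eq) v′≡

Σ1-suc : ∀ p f → Σ1 (suc p) f ≡ Σ1 p f ℕ.+ f (suc p)
Σ1-suc p f = begin
  sum (applyUpTo (f ∘ suc) (suc p))            ≡⟨ cong sum (List.applyUpTo-∷ʳ (f ∘ suc) p) ⟨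
  sum (applyUpTo (f ∘ suc) p ∷ʳ f (suc p))     ≡⟨ ℕ.sum-++ (applyUpTo (f ∘ suc) p) (f (suc p) ∷ []) ⟩
  Σ1 p f ℕ.+ (f (suc p) ℕ.+ 0)                  ≡⟨ cong (Σ1 p f ℕ.+_) (ℕ.+-identityʳ (f (suc p))) ⟩
  Σ1 p f ℕ.+ f (suc p)                          ∎
  where open ≡-Reasoning

pos-*-distribˡ-+ : ∀ a x y → + (a ℕ.* (x ℕ.+ y)) ≡ + (a ℕ.* x) + + (a ℕ.* y)
pos-*-distribˡ-+ a x y = trans (cong +_ (ℕ.*-distribˡ-+ a x y)) (ℤ.pos-+ (a ℕ.* x) (a ℕ.* y))

pos-*-suc : ∀ a j → + (a ℕ.* suc j) ≡ + a + + (a ℕ.* j)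
pos-*-suc a j = trans (cong +_ (ℕ.*-suc a j)) (ℤ.pos-+ a (a ℕ.* j))

+-pos-*-zero : ∀ a z → z + + (a ℕ.* 0) ≡ z
+-pos-*-zero a z = trans (cong (λ t → z + + t) (ℕ.*-zeroʳ a)) (ℤ.+-identityʳ z)

+-pos-*-suc : ∀ a z j → (z + + a) + + (a ℕ.* j) ≡ z + + (a ℕ.* suc j)
+-pos-*-suc a z j = begin
  (z + + a) + + (a ℕ.* j)  ≡⟨ ℤ.+-assoc z (+ a) _ ⟩
  z + (+ a + + (a ℕ.* j))  ≡⟨ cong (λ t → z + t) (pos-*-suc a j) ⟨
  z + + (a ℕ.* suc j)      ∎
  where open ≡-Reasoning

+-pos-*-suc-cancel : ∀ a z j → (z + + (a ℕ.* suc j)) - + a ≡ z + + (a ℕ.* j)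
+-pos-*-suc-cancel a z j = begin
  (z + + (a ℕ.* suc j)) - + a            ≡⟨ cong (λ t → (z + t) - + a) (pos-*-suc a j) ⟩
  (z + (+ a + + (a ℕ.* j))) - + a
    ≡⟨ solve 3 (λ z a b → (z :+ (a :+ b)) :- a := z :+ b) refl z (+ a) _ ⟩
  z + + (a ℕ.* j)                        ∎
  where open ≡-Reasoning

aSeq-closed : ∀ n m r s p → aSeq n m r s p ≡ + (n ℕ.* Σ1 p r) - + (m ℕ.* Σ1 p s)
aSeq-closed n m r s zero    = sym (cong₂ (λ x y → + x - + y) (ℕ.*-zeroʳ n) (ℕ.*-zeroʳ m))
aSeq-closed n m r s (suc p) = begin
  aSeq n m r s p + (+ (n ℕ.* r (suc p)) - + (m ℕ.* s (suc p)))
    ≡⟨ cong (_+ (+ (n ℕ.* r (suc p)) - + (m ℕ.* s (suc p)))) (aSeq-closed n m r s p) ⟩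
  (+ (n ℕ.* Σ1 p r) - + (m ℕ.* Σ1 p s)) + (+ (n ℕ.* r (suc p)) - + (m ℕ.* s (suc p)))
    ≡⟨ solve 4 (λ a b c d → (a :- b) :+ (c :- d) := (a :+ c) :- (b :+ d)) refl
         (+ (n ℕ.* Σ1 p r)) (+ (m ℕ.* Σ1 p s)) (+ (n ℕ.* r (suc p))) (+ (m ℕ.* s (suc p))) ⟩
  (+ (n ℕ.* Σ1 p r) + + (n ℕ.* r (suc p))) - (+ (m ℕ.* Σ1 p s) + + (m ℕ.* s (suc p)))
    ≡⟨ cong₂ _-_ (pos-*-distribˡ-+ n _ _) (pos-*-distribˡ-+ m _ _) ⟨
  + (n ℕ.* (Σ1 p r ℕ.+ r (suc p))) - + (m ℕ.* (Σ1 p s ℕ.+ s (suc p)))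
    ≡⟨ cong₂ (λ x y → + (n ℕ.* x) - + (m ℕ.* y)) (Σ1-suc p r) (Σ1-suc p s) ⟨
  + (n ℕ.* Σ1 (suc p) r) - + (m ℕ.* Σ1 (suc p) s) ∎
  where open ≡-Reasoning

aSeq-last : ∀ n m k r s → Σ1 k r ≡ m → Σ1 k s ≡ n → aSeq n m r s k ≡ + 0
aSeq-last n m k r s Σr Σs = begin
  aSeq n m r s k                     ≡⟨ aSeq-closed n m r s k ⟩
  + (n ℕ.* Σ1 k r) - + (m ℕ.* Σ1 k s) ≡⟨ cong₂ (λ x y → + (n ℕ.* x) - + (m ℕ.* y)) Σr Σs ⟩
  + (n ℕ.* m) - + (m ℕ.* n)          ≡⟨ cong (λ t → + t - + (m ℕ.* n)) (ℕ.*-comm n m) ⟩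
  + (m ℕ.* n) - + (m ℕ.* n)          ≡⟨ ℤ.+-inverseʳ (+ (m ℕ.* n)) ⟩
  + 0                                ∎
  where open ≡-Reasoning

data Step : Set where
  U D : Step

Us Ds : ℕ → List Step
Us a = replicate a U
Ds d = replicate d D

infix 4 _↝_ _⇝_

data _↝_ : List Step → List Step → Set where
  here  : ∀ w → U ∷ D ∷ w ↝ D ∷ U ∷ w
  there : ∀ x {w w′} → w ↝ w′ → x ∷ w ↝ x ∷ w′

_⇝_ : List Step → List Step → Set
_⇝_ = Star _↝_

⇝-prefix : ∀ p {w w′} → w ⇝ w′ → p ++ w ⇝ p ++ w′
⇝-prefix []      s = s
⇝-prefix (x ∷ p) s = gmap (x ∷_) (there x) (⇝-prefix p s)

U-past-Ds : ∀ d w → U ∷ Ds d ++ w ⇝ Ds d ++ U ∷ w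
U-past-Ds zero    w = ε
U-past-Ds (suc d) w = here (Ds d ++ w) ◅ ⇝-prefix (D ∷ []) (U-past-Ds d w)

Us-past-Ds : ∀ a d w → Us a ++ Ds d ++ w ⇝ Ds d ++ Us a ++ w
Us-past-Ds zero    d w = ε
Us-past-Ds (suc a) d w = ⇝-prefix (U ∷ []) (Us-past-Ds a d w) ◅◅ U-past-Ds d (Us a ++ w)

blocksWord : (ℕ → ℕ) → (ℕ → ℕ) → ℕ → List Step
blocksWord f g zero    = []
blocksWord f g (suc L) = Us (f 0) ++ Ds (g 0) ++ blocksWord (f ∘ suc) (g ∘ suc) L

sortBlocks : ∀ L f g → Us (sum (applyUpTo f L)) ++ Ds (sum (applyUpTo g L)) ⇝ blocksWord f g L
sortBlocks zero    f g = ε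
sortBlocks (suc L) f g =
  subst (_⇝ blocksWord f g (suc L)) (sym split)
    (⇝-prefix (Us (f 0)) (Us-past-Ds A (g 0) (Ds B) ◅◅
                           ⇝-prefix (Ds (g 0)) (sortBlocks L (f ∘ suc) (g ∘ suc))))
  where
    A = sum (applyUpTo (f ∘ suc) L)
    B = sum (applyUpTo (g ∘ suc) L)
    split : Us (f 0 ℕ.+ A) ++ Ds (g 0 ℕ.+ B) ≡ Us (f 0) ++ Us A ++ Ds (g 0) ++ Ds B
    split = trans (cong₂ _++_ (replicate-+ U (f 0) A) (replicate-+ D (g 0) B))
                  (List.++-assoc (Us (f 0)) (Us A) _)

module Path (n m : ℕ) where

  upLabels : ℤ → List Step → List ℤ
  upLabels z []      = []
  upLabels z (U ∷ w) = z ∷ upLabels (z + + n) w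
  upLabels z (D ∷ w) = upLabels (z - + m) w

  downLabels : ℤ → List Step → List ℤ
  downLabels z []      = []
  downLabels z (U ∷ w) = downLabels (z + + n) w
  downLabels z (D ∷ w) = (z - + m) ∷ downLabels (z - + m) w

  OrbitLists : List ℤ → List ℤ → Set
  OrbitLists cs bs =
    Σ (Vec ℤ n) λ c → Σ (Vec ℤ m) λ b → toList c ≡ cs × toList b ≡ bs × InOrbit n m c b

  PathInOrbit : List Step → Set
  PathInOrbit w = OrbitLists (downLabels (+ 0) w) (upLabels (+ 0) w)

  OrbitLists⇒InOrbit : ∀ {c b} → OrbitLists (toList c) (toList b) → InOrbit n m c b
  OrbitLists⇒InOrbit {c} {b} (c′ , b′ , c′≡c , b′≡b , o) =
    subst₂ (InOrbit n m) (toList-injective-≡ c′ c c′≡c) (toList-injective-≡ b′ b b′≡b) o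

  OrbitLists-τ₋ : ∀ P u Q R v S → OrbitLists (P ++ u ∷ Q) (R ++ v ∷ S) → u - v ≡ + n - + m →
                  OrbitLists (P ++ (u - + n) ∷ Q) (R ++ (v - + m) ∷ S)
  OrbitLists-τ₋ P u Q R v S (c , b , c≡ , b≡ , o) u-v
    with index-of-toList-split c P u Q (_- + n) c≡ | index-of-toList-split b R v S (_- + m) b≡
  ... | i , cᵢ≡u , c′≡ | j , bⱼ≡v , b′≡ =
    _ , _ , c′≡ , b′≡ , τ₋ i j o (trans (cong₂ _-_ cᵢ≡u bⱼ≡v) u-v)

  ↝-preserves : ∀ {w w′} → w ↝ w′ → ∀ z P R →
                OrbitLists (P ++ downLabels z w) (R ++ upLabels z w) →
                OrbitLists (P ++ downLabels z w′) (R ++ upLabels z w′)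
  ↝-preserves (here w) z P R o =
    subst₂ (λ h h′ → OrbitLists (P ++ h ∷ downLabels h′ w) (R ++ (z - + m) ∷ upLabels h′ w))
      (solve 3 (λ z a b → ((z :+ a) :- b) :- a := z :- b) refl z (+ n) (+ m))
      (solve 3 (λ z a b → (z :+ a) :- b := (z :- b) :+ a) refl z (+ n) (+ m))
      (OrbitLists-τ₋ P _ _ R z _ o
        (solve 3 (λ z a b → ((z :+ a) :- b) :- z := a :- b) refl z (+ n) (+ m)))
  ↝-preserves (there U s) z P R o =
    subst (OrbitLists _) (List.∷ʳ-++ R z _)
      (↝-preserves s (z + + n) P (R ∷ʳ z) (subst (OrbitLists _) (sym (List.∷ʳ-++ R z _)) o))
  ↝-preserves (there D s) z P R o =
    subst (λ cs → OrbitLists cs _) (List.∷ʳ-++ P (z - + m) _)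
      (↝-preserves s (z - + m) (P ∷ʳ (z - + m)) R
        (subst (λ cs → OrbitLists cs _) (sym (List.∷ʳ-++ P (z - + m) _)) o))

  ⇝-preserves : ∀ {w w′} → w ⇝ w′ → PathInOrbit w → PathInOrbit w′
  ⇝-preserves ε        o = o
  ⇝-preserves (s ◅ ss) o = ⇝-preserves ss (↝-preserves s (+ 0) [] [] o)

  upLabels-Us : ∀ a z w → upLabels z (Us a ++ w) ≡ bBlock n z a ++ upLabels (z + + (n ℕ.* a)) w
  upLabels-Us zero    z w = cong (λ t → upLabels t w) (sym (+-pos-*-zero n z))
  upLabels-Us (suc a) z w = cong₂ _∷_ (sym (+-pos-*-zero n z))
    (trans (upLabels-Us a (z + + n) w)
           (cong₂ _++_ (applyUpTo-cong (+-pos-*-suc n z) a)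
                       (cong (λ t → upLabels t w) (+-pos-*-suc n z a))))

  downLabels-Us : ∀ a z w → downLabels z (Us a ++ w) ≡ downLabels (z + + (n ℕ.* a)) w
  downLabels-Us zero    z w = cong (λ t → downLabels t w) (sym (+-pos-*-zero n z))
  downLabels-Us (suc a) z w =
    trans (downLabels-Us a (z + + n) w) (cong (λ t → downLabels t w) (+-pos-*-suc n z a))

  upLabels-Ds : ∀ d z w → upLabels (z + + (m ℕ.* d)) (Ds d ++ w) ≡ upLabels z w
  upLabels-Ds zero    z w = cong (λ t → upLabels t w) (+-pos-*-zero m z)
  upLabels-Ds (suc d) z w =
    trans (cong (λ t → upLabels t (Ds d ++ w)) (+-pos-*-suc-cancel m z d)) (upLabels-Ds d z w)

  downLabels-Ds : ∀ d z w → downLabels (z + + (m ℕ.* d)) (Ds d ++ w) ≡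
                            applyDownFrom (λ j → z + + (m ℕ.* j)) d ++ downLabels z w
  downLabels-Ds zero    z w = cong (λ t → downLabels t w) (+-pos-*-zero m z)
  downLabels-Ds (suc d) z w = cong₂ _∷_ (+-pos-*-suc-cancel m z d)
    (trans (cong (λ t → downLabels t (Ds d ++ w)) (+-pos-*-suc-cancel m z d)) (downLabels-Ds d z w))

  Λ₀-path : PathInOrbit (Us m ++ Ds n)
  Λ₀-path = Λ₀c n m , Λ₀b n m , c≡ , b≡ , base
    where
      open ≡-Reasoning
      b≡ : toList (Λ₀b n m) ≡ upLabels (+ 0) (Us m ++ Ds n)
      b≡ = begin
        toList (Λ₀b n m)                             ≡⟨ toList-tabulate-upward m (λ j → + (n ℕ.* j)) ⟩
        bBlock n (+ 0) m                             ≡⟨ List.++-identityʳ _ ⟨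
        bBlock n (+ 0) m ++ upLabels (+ 0) []
                                                     ≡⟨ cong (bBlock n (+ 0) m ++_) (upLabels-Ds n (+ 0) []) ⟨
        bBlock n (+ 0) m ++ upLabels (+ (m ℕ.* n)) (Ds n ++ [])
                                                     ≡⟨ cong₂ (λ t w → bBlock n (+ 0) m ++ upLabels (+ t) w)
                                                              (ℕ.*-comm m n) (List.++-identityʳ (Ds n)) ⟩
        bBlock n (+ 0) m ++ upLabels (+ (n ℕ.* m)) (Ds n)
                                                     ≡⟨ upLabels-Us m (+ 0) (Ds n) ⟨
        upLabels (+ 0) (Us m ++ Ds n)                ∎
      c≡ : toList (Λ₀c n m) ≡ downLabels (+ 0) (Us m ++ Ds n)
      c≡ = begin
        toList (Λ₀c n m)                             ≡⟨ toList-tabulate-downward n (λ j → + (m ℕ.* j)) ⟩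
        applyDownFrom (λ j → + (m ℕ.* j)) n          ≡⟨ List.++-identityʳ _ ⟨
        applyDownFrom (λ j → + (m ℕ.* j)) n ++ []    ≡⟨ downLabels-Ds n (+ 0) [] ⟨
        downLabels (+ (m ℕ.* n)) (Ds n ++ [])        ≡⟨ cong₂ (λ t w → downLabels (+ t) w)
                                                              (ℕ.*-comm m n) (List.++-identityʳ (Ds n)) ⟩
        downLabels (+ (n ℕ.* m)) (Ds n)              ≡⟨ downLabels-Us m (+ 0) (Ds n) ⟨
        downLabels (+ 0) (Us m ++ Ds n)              ∎

  BlockHeights : (ℕ → ℕ) → (ℕ → ℕ) → (ℕ → ℤ) → Set
  BlockHeights f g A = ∀ i → A (suc i) ≡ A i + (+ (n ℕ.* f i) - + (m ℕ.* g i))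

  top-of-block : ∀ a₀ a₁ x y → a₁ ≡ a₀ + (x - y) → a₀ + x ≡ a₁ + y
  top-of-block a₀ a₁ x y a₁≡ =
    trans (solve 3 (λ a x y → a :+ x := (a :+ (x :- y)) :+ y) refl a₀ x y) (cong (_+ y) (sym a₁≡))

  upLabels-blocksWord : ∀ L f g A → BlockHeights f g A →
    upLabels (A 0) (blocksWord f g L) ≡ concat (applyUpTo (λ i → bBlock n (A i) (f i)) L)
  upLabels-blocksWord zero    f g A H = refl
  upLabels-blocksWord (suc L) f g A H = begin
    upLabels (A 0) (blocksWord f g (suc L))
      ≡⟨ upLabels-Us (f 0) (A 0) _ ⟩
    bBlock n (A 0) (f 0) ++ upLabels (A 0 + + (n ℕ.* f 0)) (Ds (g 0) ++ rest)
      ≡⟨ cong (λ t → bBlock n (A 0) (f 0) ++ upLabels t (Ds (g 0) ++ rest))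
              (top-of-block (A 0) (A 1) _ _ (H 0)) ⟩
    bBlock n (A 0) (f 0) ++ upLabels (A 1 + + (m ℕ.* g 0)) (Ds (g 0) ++ rest)
      ≡⟨ cong (bBlock n (A 0) (f 0) ++_) (upLabels-Ds (g 0) (A 1) rest) ⟩
    bBlock n (A 0) (f 0) ++ upLabels (A 1) rest
      ≡⟨ cong (bBlock n (A 0) (f 0) ++_)
              (upLabels-blocksWord L (f ∘ suc) (g ∘ suc) (A ∘ suc) (H ∘ suc)) ⟩
    concat (applyUpTo (λ i → bBlock n (A i) (f i)) (suc L)) ∎
    where
      open ≡-Reasoning
      rest = blocksWord (f ∘ suc) (g ∘ suc) L

  downLabels-blocksWord : ∀ L f g A → BlockHeights f g A →
    downLabels (A 0) (blocksWord f g L) ≡ concat (applyUpTo (λ i → cBlock m (A (suc i)) (g i)) L)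
  downLabels-blocksWord zero    f g A H = refl
  downLabels-blocksWord (suc L) f g A H = begin
    downLabels (A 0) (blocksWord f g (suc L))
      ≡⟨ downLabels-Us (f 0) (A 0) _ ⟩
    downLabels (A 0 + + (n ℕ.* f 0)) (Ds (g 0) ++ rest)
      ≡⟨ cong (λ t → downLabels t (Ds (g 0) ++ rest)) (top-of-block (A 0) (A 1) _ _ (H 0)) ⟩
    downLabels (A 1 + + (m ℕ.* g 0)) (Ds (g 0) ++ rest)
      ≡⟨ downLabels-Ds (g 0) (A 1) rest ⟩
    applyDownFrom (λ j → A 1 + + (m ℕ.* j)) (g 0) ++ downLabels (A 1) rest
      ≡⟨ cong₂ _++_ (sym (List.reverse-applyUpTo _ (g 0)))
                    (downLabels-blocksWord L (f ∘ suc) (g ∘ suc) (A ∘ suc) (H ∘ suc)) ⟩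
    concat (applyUpTo (λ i → cBlock m (A (suc i)) (g i)) (suc L)) ∎
    where
      open ≡-Reasoning
      rest = blocksWord (f ∘ suc) (g ∘ suc) L

  upLabels-bList : ∀ k r s →
                   upLabels (+ 0) (blocksWord (r ∘ suc) (s ∘ suc) (suc k)) ≡ bList n m (suc k) r s
  upLabels-bList k r s = upLabels-blocksWord (suc k) (r ∘ suc) (s ∘ suc) (aSeq n m r s) (λ i → refl)

  downLabels-cList : ∀ k r s → aSeq n m r s (suc k) ≡ + 0 →
                     downLabels (+ 0) (blocksWord (r ∘ suc) (s ∘ suc) (suc k)) ≡ cList n m (suc k) r s
  downLabels-cList k r s aₖ≡0 = begin
    downLabels (+ 0) (blocksWord (r ∘ suc) (s ∘ suc) (suc k))
      ≡⟨ downLabels-blocksWord (suc k) (r ∘ suc) (s ∘ suc) (aSeq n m r s) (λ i → refl) ⟩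
    concat (applyUpTo C (suc k))           ≡⟨ cong concat (List.applyUpTo-∷ʳ C k) ⟨
    concat (applyUpTo C k ∷ʳ C k)          ≡⟨ List.concat-++ (applyUpTo C k) (C k ∷ []) ⟨
    concat (applyUpTo C k) ++ (C k ++ [])  ≡⟨ cong (concat (applyUpTo C k) ++_) (List.++-identityʳ (C k)) ⟩
    concat (applyUpTo C k) ++ C k
      ≡⟨ cong (λ t → concat (applyUpTo C k) ++ cBlock m t (s (suc k))) aₖ≡0 ⟩
    cList n m (suc k) r s                  ∎
    where
      open ≡-Reasoning
      C = λ i → cBlock m (aSeq n m r s (suc i)) (s (suc i))

proposition6p2 : (m n k : ℕ) → 1 ≤ n → n < m → 1 ≤ k →
    (r s : ℕ → ℕ) →
    (∀ i → 1 ≤ i → i ≤ k → 1 ≤ r i) →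
    (∀ i → 1 ≤ i → i ≤ k → 1 ≤ s i) →
    Σ1 k r ≡ m → Σ1 k s ≡ n →
    (c : Vec ℤ n) (b : Vec ℤ m) →
    toList c ≡ cList n m k r s → toList b ≡ bList n m k r s →
    InOrbit n m c b
proposition6p2 m n zero    _ _ () r s _ _ _  _  c b _  _
proposition6p2 m n (suc k) _ _ _  r s _ _ Σr Σs c b c≡ b≡ =
  OrbitLists⇒InOrbit (subst₂ OrbitLists
    (trans (downLabels-cList k r s (aSeq-last n m (suc k) r s Σr Σs)) (sym c≡))
    (trans (upLabels-bList k r s) (sym b≡))
    (⇝-preserves (sortBlocks (suc k) (r ∘ suc) (s ∘ suc)) Λ₀-sorted))
  where
    open Path n m
    Λ₀-sorted : PathInOrbit (Us (Σ1 (suc k) r) ++ Ds (Σ1 (suc k) s))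
    Λ₀-sorted = subst₂ (λ a d → PathInOrbit (Us a ++ Ds d)) (sym Σr) (sym Σs) Λ₀-path
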